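{- For all integers $n\geq 4$, we have $\mathrm{tc}_{5,2}(K_n) = 2$.
   Context: For integers $r\geq k\geq 1$, an $(r,k)$-colouring of a graph $G$ is a function $\varphi:E(G)\to\binom{[r]}{k}$, assigning to each edge a set of exactly $k$ colours from $[r]=\{1,\dots,r\}$. A subgraph $H\subseteq G$ is monochromatic if there is a colour $i$ belonging to $\varphi(e)$ for every $e\in E(H)$. For an $(r,k)$-colouring $\varphi$ of $G$, $\mathrm{tc}(G,\varphi)$ is the minimum number of monochromatic trees (not necessarily of the same colour; a single vertex counts as a tree) whose union covers $V(G)$. The tree cover number $\mathrm{tc}_{r,k}(G)$ is the minimum $m$ such that every $(r,k)$-colouring $\varphi$ of $E(G)$ satisfies $\mathrm{tc}(G,\varphi)\leq m$. -}

module Defs where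

open import Data.Nat using (ℕ; suc; _≤_)
open import Data.Fin using (Fin)
open import Data.Fin.Subset using (Subset; ∣_∣) renaming (_∈_ to _∈ₛ_)
open import Data.List using (List; []; _∷_; length)
open import Data.List.Membership.Propositional using (_∈_; _∉_)
open import Data.List.Relation.Unary.Any using (Any)
open import Data.Product using (Σ; _×_; ∃; proj₁; proj₂)
open import Relation.Binary.PropositionalEquality using (_≡_; _≢_)
open import Relation.Nullary using (¬_)

-- Edges are unordered, so the colour set is symmetric; the diagonal is irrelevant.
record Colouring (n r k : ℕ) : Set where
  field
    col  : Fin n → Fin n → Subset r
    sym  : ∀ u v → u ≢ v → col u v ≡ col v u
    size : ∀ u v → u ≢ v → ∣ col u v ∣ ≡ k
open Colouring public

data MonoTree {n r k : ℕ} (φ : Colouring n r k) (i : Fin r) : List (Fin n) → Set where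
  single : (v : Fin n) → MonoTree φ i (v ∷ [])
  leaf   : ∀ {T} → MonoTree φ i T → (u v : Fin n) → u ∈ T → v ∉ T →
           i ∈ₛ col φ u v → MonoTree φ i (v ∷ T)

MonoTreeIn : {n r k : ℕ} → Colouring n r k → Set
MonoTreeIn {n} {r} φ = Σ (Fin r) λ i → Σ (List (Fin n)) λ T → MonoTree φ i T

vertices : {n r k : ℕ} {φ : Colouring n r k} → MonoTreeIn φ → List (Fin n)
vertices t = proj₁ (proj₂ t)

tcAtMost : {n r k : ℕ} → Colouring n r k → ℕ → Set
tcAtMost {n} φ m = Σ (List (MonoTreeIn φ)) λ ts →
  length ts ≤ m × (∀ (v : Fin n) → Any (λ t → v ∈ vertices t) ts)

-- Stated for m = suc m' to avoid truncated subtraction.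
tcEqualsSuc : (n r k m' : ℕ) → Set
tcEqualsSuc n r k m' =
  ((φ : Colouring n r k) → tcAtMost φ (suc m')) ×
  (∃ λ (φ : Colouring n r k) → ¬ tcAtMost φ m')

-- Upper bound: fix a vertex x₀ and, for every colour c, the colour-c component A_c of x₀.
-- The profile of a vertex w is the set of colours c with w ∈ A_c.  Every profile contains
-- the two colours of the edge x₀w, and the profiles of u and w agree on the two colours of
-- the edge uw.  A finite check over subsets of the five colours shows that such a family
-- of profiles has a transversal {i, j}, and then A_i and A_j cover K_n.
-- Lower bound: split the vertices into four nonempty parts so that no edge at a vertex of
-- part s carries colour s, and leave colour 4 unused.  Each colour then has a vertex
-- without edges of that colour, so no single monochromatic tree spans K_n.
module Submission where

open import Defs hiding (sym)
open import Data.Bool using (if_then_else_)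
open import Data.Nat using (ℕ; zero; suc; _+_; _≤_; _<_; _≥_; _≤?_; z≤n; s≤s)
open import Data.Nat.Properties
  using (≤-refl; ≤-trans; ≤-reflexive; ≤∧≢⇒<; ≰⇒>; <⇒≱; n<1+n; +-identityʳ; +-suc)
  renaming (_≟_ to _≟ℕ_)
open import Data.Fin using (Fin; zero; suc; inject₁; _↑ˡ_; punchIn; _≟_)
open import Data.Fin.Patterns using (0F; 1F; 2F; 3F; 4F)
open import Data.Fin.Properties using (any?; all?; ¬∀⟶∃¬; pigeonhole; punchInᵢ≢i; <⇒≢)
open import Data.Fin.Subset
  using (Subset; ∣_∣; _⊆_; _∩_; _∪_; ∁; ⁅_⁆; ⊤; inside; outside) renaming (_∈_ to _∈ₛ_; _∉_ to _∉ₛ_)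
open import Data.Fin.Subset.Properties
  using (p⊆q⇒∣p∣≤∣q∣; ∣⊤∣≡n; ∈⊤; x∈p∩q⁺; x∈p∪q⁺; x∉p⇒x∈∁p) renaming (_∈?_ to _∈ₛ?_)
open import Data.List using (List; []; _∷_; length; lookup)
open import Data.List.Membership.Propositional using (_∈_; _∉_)
open import Data.List.Membership.Propositional.Properties using (∈-lookup)
open import Data.List.Relation.Unary.All as All using ([])
open import Data.List.Relation.Unary.All.Properties using (¬Any⇒All¬)
open import Data.List.Relation.Unary.AllPairs using ([]; _∷_)
open import Data.List.Relation.Unary.Any using (here; there)
open import Data.List.Relation.Unary.Unique.Propositional using (Unique)
open import Data.Product using (∃; ∃₂; _×_; _,_)
open import Data.Sum using (_⊎_; inj₁; inj₂)
import Data.Sum as Sum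
open import Data.Empty using (⊥; ⊥-elim)
open import Data.Vec using ([]; _∷_; tabulate)
open import Data.Vec.Properties using (lookup∘tabulate; []=⇒lookup; lookup⇒[]=) renaming (≡-dec to ≡-decᵛ)
import Data.Bool.Properties as Bool
open import Function using (_∘_; id)
open import Relation.Binary.PropositionalEquality using (_≡_; _≢_; refl; sym; trans; cong; subst)
open import Relation.Nullary using (Dec; yes; no; does; ¬_; ¬?)
open import Relation.Nullary.Decidable
  using (from-yes; map′; dec-true; _×-dec_; _⊎-dec_; _→-dec_)
open import Relation.Unary using (Pred; Decidable)

unique-lookup-injective : ∀ {a} {A : Set a} {xs : List A} → Unique xs →
                          ∀ p q → lookup xs p ≡ lookup xs q → p ≡ q
unique-lookup-injective (_ ∷ _) zero zero _ = refl
unique-lookup-injective (x∉xs ∷ _) zero (suc q) eq = ⊥-elim (All.lookup x∉xs (∈-lookup q) eq)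
unique-lookup-injective (x∉xs ∷ _) (suc p) zero eq = ⊥-elim (All.lookup x∉xs (∈-lookup p) (sym eq))
unique-lookup-injective (_ ∷ u) (suc p) (suc q) eq = cong suc (unique-lookup-injective u p q eq)

unique⇒length≤ : ∀ {n} {xs : List (Fin n)} → Unique xs → length xs ≤ n
unique⇒length≤ {n} {xs} u with length xs ≤? n
... | yes l≤n = l≤n
... | no l≰n with pigeonhole (≰⇒> l≰n) (lookup xs)
...   | p , q , p<q , eq = ⊥-elim (<⇒≢ p<q (unique-lookup-injective u p q eq))

agreement : ∀ {n} → Subset n → Subset n → Subset n
agreement p q = (p ∩ q) ∪ (∁ p ∩ ∁ q)

∈-agreement : ∀ {n} {c : Fin n} {p q} → (c ∈ₛ p → c ∈ₛ q) → (c ∈ₛ q → c ∈ₛ p) → c ∈ₛ agreement p q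
∈-agreement {c = c} {p} to from with c ∈ₛ? p
... | yes c∈p = x∈p∪q⁺ (inj₁ (x∈p∩q⁺ (c∈p , to c∈p)))
... | no c∉p = x∈p∪q⁺ (inj₂ (x∈p∩q⁺ (x∉p⇒x∈∁p c∉p , x∉p⇒x∈∁p (c∉p ∘ from))))

k≤∣p∣⇒p⊆q⇒k≤∣q∣ : ∀ {n k} {p q : Subset n} → k ≤ ∣ p ∣ → p ⊆ q → k ≤ ∣ q ∣
k≤∣p∣⇒p⊆q⇒k≤∣q∣ k≤∣p∣ p⊆q = ≤-trans k≤∣p∣ (p⊆q⇒∣p∣≤∣q∣ p⊆q)

k≤∣⊤∣ : ∀ {n k} → k ≤ n → k ≤ ∣ ⊤ {n} ∣
k≤∣⊤∣ {n} k≤n = subst (_ ≤_) (sym (∣⊤∣≡n n)) k≤n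

⊤⊆agreement-self : ∀ {n} (p : Subset n) → ⊤ ⊆ agreement p p
⊤⊆agreement-self p _ = ∈-agreement id id

allSubset? : ∀ {n ℓ} {P : Pred (Subset n) ℓ} → Decidable P → Dec (∀ p → P p)
allSubset? {zero} P? = map′ (λ { h [] → h }) (λ h → h []) (P? [])
allSubset? {suc n} P? =
  map′ (λ { (h₁ , h₀) (inside ∷ p) → h₁ p ; (h₁ , h₀) (outside ∷ p) → h₀ p })
       (λ h → (λ p → h (inside ∷ p)) , (λ p → h (outside ∷ p)))
       (allSubset? (λ p → P? (inside ∷ p)) ×-dec allSubset? (λ p → P? (outside ∷ p)))

module _ {n r k : ℕ} (φ : Colouring n r k) (i : Fin r) where

  open import Data.List.Membership.DecPropositional (_≟_ {n}) using (_∈?_)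

  monoTree-unique : ∀ {T} → MonoTree φ i T → Unique T
  monoTree-unique (single _) = [] ∷ []
  monoTree-unique (leaf {T} t _ _ _ v∉T _) = ¬Any⇒All¬ T v∉T ∷ monoTree-unique t

  record Component (x : Fin n) : Set where
    field
      members : List (Fin n)
      tree    : MonoTree φ i members
      root∈   : x ∈ members
      closed  : ∀ {u w} → u ∈ members → w ∉ members → i ∉ₛ col φ u w

  ExitEdge : List (Fin n) → Set
  ExitEdge T = ∃₂ λ u w → u ∈ T × w ∉ T × i ∈ₛ col φ u w

  exitEdge? : ∀ T → Dec (ExitEdge T)
  exitEdge? T = any? λ u → any? λ w → u ∈? T ×-dec ¬? (w ∈? T) ×-dec i ∈ₛ? col φ u w

  -- Keep adding leaves along exit edges; the fuel runs out only if the tree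
  -- has more than n vertices, which monoTree-unique rules out.
  grow : ∀ fuel {x T} → MonoTree φ i T → x ∈ T → n < length T + fuel → Component x
  grow zero t _ n<l = ⊥-elim (<⇒≱ (subst (n <_) (+-identityʳ _) n<l) (unique⇒length≤ (monoTree-unique t)))
  grow (suc fuel) {T = T} t x∈T n<l with exitEdge? T
  ... | yes (u , w , u∈T , w∉T , c) =
        grow fuel (leaf t u w u∈T w∉T c) (there x∈T) (subst (n <_) (+-suc (length T) fuel) n<l)
  ... | no ¬exit = record
        { members = T ; tree = t ; root∈ = x∈T
        ; closed = λ u∈T w∉T c → ¬exit (_ , _ , u∈T , w∉T , c) }

  component : ∀ x → Component x
  component x = grow n (single x) (here refl) (n<1+n n)

  component-edge : ∀ {x u w} (A : Component x) → u ∈ Component.members A →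
                   i ∈ₛ col φ u w → w ∈ Component.members A
  component-edge {w = w} A u∈A c with w ∈? Component.members A
  ... | yes w∈A = w∈A
  ... | no w∉A = ⊥-elim (Component.closed A u∈A w∉A c)

module Profiles {n r k : ℕ} (φ : Colouring n r k) (x₀ : Fin n) where

  open import Data.List.Membership.DecPropositional (_≟_ {n}) using (_∈?_)

  A : (c : Fin r) → Component φ c x₀
  A c = component φ c x₀

  profile : Fin n → Subset r
  profile w = tabulate λ c → does (w ∈? Component.members (A c))

  ∈-profile⁺ : ∀ {c w} → w ∈ Component.members (A c) → c ∈ₛ profile w
  ∈-profile⁺ {c} {w} w∈A =
    lookup⇒[]= c (profile w) (trans (lookup∘tabulate _ c) (dec-true (w ∈? _) w∈A))

  ∈-profile⁻ : ∀ {c w} → c ∈ₛ profile w → w ∈ Component.members (A c)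
  ∈-profile⁻ {c} {w} c∈
    with w ∈? Component.members (A c) | trans (sym (lookup∘tabulate _ c)) ([]=⇒lookup c∈)
  ... | yes w∈A | _ = w∈A
  ... | no _ | ()

  profile-edge : ∀ {c u w} → c ∈ₛ col φ u w → c ∈ₛ profile u → c ∈ₛ profile w
  profile-edge c∈uw c∈u = ∈-profile⁺ (component-edge φ _ (A _) (∈-profile⁻ c∈u) c∈uw)

  ⊤⊆profile-root : ⊤ ⊆ profile x₀
  ⊤⊆profile-root _ = ∈-profile⁺ (Component.root∈ (A _))

  root-edge⊆profile : ∀ w → col φ x₀ w ⊆ profile w
  root-edge⊆profile w c∈ = profile-edge c∈ (⊤⊆profile-root ∈⊤)

  edge⊆agreement : ∀ u w → u ≢ w → col φ u w ⊆ agreement (profile u) (profile w)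
  edge⊆agreement u w u≢w {c} c∈ =
    ∈-agreement (profile-edge c∈) (profile-edge (subst (c ∈ₛ_) (Colouring.sym φ u w u≢w) c∈))

  profile-size : k ≤ r → ∀ w → k ≤ ∣ profile w ∣
  profile-size k≤r w with x₀ ≟ w
  ... | yes refl = k≤∣p∣⇒p⊆q⇒k≤∣q∣ (k≤∣⊤∣ k≤r) ⊤⊆profile-root
  ... | no x₀≢w = k≤∣p∣⇒p⊆q⇒k≤∣q∣ (≤-reflexive (sym (size φ x₀ w x₀≢w))) (root-edge⊆profile w)

  profile-agreement : k ≤ r → ∀ u w → k ≤ ∣ agreement (profile u) (profile w) ∣
  profile-agreement k≤r u w with u ≟ w
  ... | yes refl = k≤∣p∣⇒p⊆q⇒k≤∣q∣ (k≤∣⊤∣ k≤r) (⊤⊆agreement-self (profile u))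
  ... | no u≢w = k≤∣p∣⇒p⊆q⇒k≤∣q∣ (≤-reflexive (sym (size φ u w u≢w))) (edge⊆agreement u w u≢w)

  profile-cover : ∀ i j → (∀ w → i ∈ₛ profile w ⊎ j ∈ₛ profile w) → tcAtMost φ 2
  profile-cover i j hits =
    treeOf i ∷ treeOf j ∷ [] , ≤-refl ,
    λ w → Sum.[ here ∘ ∈-profile⁻ , there ∘ here ∘ ∈-profile⁻ ]′ (hits w)
    where
      treeOf : Fin r → MonoTreeIn φ
      treeOf c = c , Component.members (A c) , Component.tree (A c)

-- i and j are the elements of P: a Q missing both differs from P on the ≥ 4 colours of P ∪ Q.
pair-transversal : ∀ (P : Subset 5) → ∣ P ∣ ≡ 2 → ∃₂ λ i j →
                   ∀ Q → 2 ≤ ∣ Q ∣ → 2 ≤ ∣ agreement P Q ∣ → i ∈ₛ Q ⊎ j ∈ₛ Q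
pair-transversal = from-yes
  (allSubset? {5} λ P → ∣ P ∣ ≟ℕ 2 →-dec any? {5} λ i → any? {5} λ j → allSubset? {5} λ Q →
     2 ≤? ∣ Q ∣ →-dec 2 ≤? ∣ agreement P Q ∣ →-dec (i ∈ₛ? Q ⊎-dec j ∈ₛ? Q))

-- P avoids 0 and 1, so P = {2,3,4}; a Q of size ≥ 3 avoiding 2 and 3 would be {0,1,4},
-- which disagrees with P on four colours.
large-crossing : ∀ (P Q : Subset 5) → 3 ≤ ∣ P ∣ → 3 ≤ ∣ Q ∣ → 2 ≤ ∣ agreement P Q ∣ →
                 ¬ (0F ∈ₛ P ⊎ 1F ∈ₛ P) → 2F ∈ₛ Q ⊎ 3F ∈ₛ Q
large-crossing = from-yes
  (allSubset? {5} λ P → allSubset? {5} λ Q →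
     3 ≤? ∣ P ∣ →-dec 3 ≤? ∣ Q ∣ →-dec 2 ≤? ∣ agreement P Q ∣ →-dec
     ¬? (0F ∈ₛ? P ⊎-dec 1F ∈ₛ? P) →-dec (2F ∈ₛ? Q ⊎-dec 3F ∈ₛ? Q))

large-transversal : ∀ {n} (P : Fin n → Subset 5) → (∀ u → 3 ≤ ∣ P u ∣) →
                    (∀ u w → 2 ≤ ∣ agreement (P u) (P w) ∣) →
                    ∃₂ λ i j → ∀ u → i ∈ₛ P u ⊎ j ∈ₛ P u
large-transversal {n} P large compatible = decide (all? hits01?)
  where
    hits01? : ∀ u → Dec (0F ∈ₛ P u ⊎ 1F ∈ₛ P u)
    hits01? u = 0F ∈ₛ? P u ⊎-dec 1F ∈ₛ? P u

    decide : Dec (∀ u → 0F ∈ₛ P u ⊎ 1F ∈ₛ P u) → ∃₂ λ i j → ∀ u → i ∈ₛ P u ⊎ j ∈ₛ P u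
    decide (yes hits01) = 0F , 1F , hits01
    decide (no ¬hits01) =
      let (w , misses01) = ¬∀⟶∃¬ n _ hits01? ¬hits01
      in 2F , 3F , λ u → large-crossing (P w) (P u) (large w) (large u) (compatible w u) misses01

compatible-transversal : ∀ {n} (P : Fin n → Subset 5) → (∀ u → 2 ≤ ∣ P u ∣) →
                         (∀ u w → 2 ≤ ∣ agreement (P u) (P w) ∣) →
                         ∃₂ λ i j → ∀ u → i ∈ₛ P u ⊎ j ∈ₛ P u
compatible-transversal P large compatible with any? (λ u → ∣ P u ∣ ≟ℕ 2)
... | yes (w , ∣Pw∣≡2) =
  let (i , j , meets) = pair-transversal (P w) ∣Pw∣≡2
  in i , j , λ u → meets (P u) (large u) (compatible w u)
... | no ¬pair =
  large-transversal P (λ u → ≤∧≢⇒< (large u) (λ 2≡∣Pu∣ → ¬pair (u , sym 2≡∣Pu∣))) compatible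

tcAtMost2 : ∀ {m} (φ : Colouring (suc m) 5 2) → tcAtMost φ 2
tcAtMost2 φ =
  let open Profiles φ zero
      2≤5 = s≤s (s≤s z≤n)
      (i , j , hits) = compatible-transversal profile (profile-size 2≤5) (profile-agreement 2≤5)
  in profile-cover i j hits

Isolated : ∀ {n r k} → Colouring n r k → Fin r → Fin n → Set
Isolated φ i x = ∀ w → x ≢ w → i ∉ₛ col φ x w

isolated⇒singleton : ∀ {n r k} {φ : Colouring n r k} {i x T} → Isolated φ i x →
                     MonoTree φ i T → x ∈ T → T ≡ x ∷ []
isolated⇒singleton iso (single _) (here refl) = refl
isolated⇒singleton {φ = φ} iso (leaf t u v u∈T v∉T c) (here refl) =
  ⊥-elim (iso u v≢u (subst (_ ∈ₛ_) (Colouring.sym φ u v (v≢u ∘ sym)) c))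
  where
    v≢u : v ≢ u
    v≢u v≡u = v∉T (subst (_∈ _) (sym v≡u) u∈T)
isolated⇒singleton iso (leaf t u v u∈T v∉T c) (there x∈T)
  with isolated⇒singleton iso t x∈T | u∈T
... | refl | here refl = ⊥-elim (iso v (λ x≡v → v∉T (here (sym x≡v))) c)

isolated⇒¬tcAtMost1 : ∀ {m r k} {φ : Colouring (suc (suc m)) r k} →
                      (∀ i → ∃ (Isolated φ i)) → ¬ tcAtMost φ 1
isolated⇒¬tcAtMost1 iso ([] , _ , covers) with covers zero
... | ()
isolated⇒¬tcAtMost1 {φ = φ} iso ((i , T , t) ∷ [] , _ , covers) = no-second-vertex (iso i)
  where
    spans : ∀ v → v ∈ T
    spans v with covers v
    ... | here v∈T = v∈T

    no-second-vertex : ∃ (Isolated φ i) → ⊥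
    no-second-vertex (x , x-iso)
      with subst (punchIn x zero ∈_) (isolated⇒singleton x-iso t (spans x)) (spans (punchIn x zero))
    ... | here y≡x = punchInᵢ≢i x zero y≡x
isolated⇒¬tcAtMost1 iso (_ ∷ _ ∷ _ , s≤s () , _)

partner : Fin 4 → Fin 4
partner 0F = 1F
partner 1F = 0F
partner 2F = 3F
partner 3F = 2F

-- Edges between parts s ≠ t get the colours {0,1,2,3} ∖ {s,t}, edges inside part s
-- get {0,1,2,3} ∖ {s, partner s}.
partColours : Fin 4 → Fin 4 → Subset 5
partColours s t = ∁ (⁅ 4F ⁆ ∪ ⁅ inject₁ s ⁆ ∪ ⁅ inject₁ (if does (s ≟ t) then partner s else t) ⁆)

partColours-sym : ∀ s t → partColours s t ≡ partColours t s
partColours-sym = from-yes (all? λ s → all? λ t → ≡-decᵛ Bool._≟_ (partColours s t) (partColours t s))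

partColours-size : ∀ s t → ∣ partColours s t ∣ ≡ 2
partColours-size = from-yes (all? λ s → all? λ t → ∣ partColours s t ∣ ≟ℕ 2)

partColours-avoid : ∀ c → ∃ λ s → ∀ t → c ∉ₛ partColours s t
partColours-avoid = from-yes (all? λ c → any? λ s → all? λ t → ¬? (c ∈ₛ? partColours s t))

part : ∀ {m} → Fin (4 + m) → Fin 4
part 0F = 0F
part 1F = 1F
part 2F = 2F
part (suc (suc (suc _))) = 3F

part-↑ˡ : ∀ m s → part (s ↑ˡ m) ≡ s
part-↑ˡ m 0F = refl
part-↑ˡ m 1F = refl
part-↑ˡ m 2F = refl
part-↑ˡ m 3F = refl

partColouring : ∀ m → Colouring (4 + m) 5 2
partColouring m = record
  { col  = λ u w → partColours (part u) (part w)
  ; sym  = λ u w _ → partColours-sym (part u) (part w)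
  ; size = λ u w _ → partColours-size (part u) (part w)
  }

partColouring-isolated : ∀ m c → ∃ (Isolated (partColouring m) c)
partColouring-isolated m c =
  let (s , avoids) = partColours-avoid c
  in s ↑ˡ m , λ w _ → subst (λ s′ → c ∉ₛ partColours s′ (part w)) (sym (part-↑ˡ m s)) (avoids (part w))

theorem1p3 : (n : ℕ) → n ≥ 4 → tcEqualsSuc n 5 2 1
theorem1p3 _ (s≤s (s≤s (s≤s (s≤s (z≤n {m}))))) =
  tcAtMost2 , partColouring m , isolated⇒¬tcAtMost1 (partColouring-isolated m)
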